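{- Let $V$ be a vector space of finite dimension $r$ over $\mathbb{F}_q$ with $q\neq 2$, and let $A$ be a non-empty subset of $V$. If $A$ is an $S_h$-linear set with $2h<r\leq|A|$, then $A\cup\{\boldsymbol{0}\}$ is also an $S_h$-linear set.
   Context: For a non-empty subset $A$ of $V$ and a positive integer $h\leq|A|$, an $h$-linear combination of $A$ is an expression $\lambda_1\boldsymbol{a}_1+\cdots+\lambda_h\boldsymbol{a}_h$ with $\lambda_i\in\mathbb{F}_q^*$ and $\boldsymbol{a}_1,\dots,\boldsymbol{a}_h$ distinct elements of $A$. $A$ is an $S_h$-linear set if all $h$-linear combinations of elements of $A$, omitting permutations of the summands, yield distinct elements of $V$. (As in the paper, when the zero vector belongs to the set, combinations differing only in the scalar attached to $\boldsymbol{0}$ are regarded as the same combination.) -}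

module Defs where

open import Level using (Level; _⊔_) renaming (suc to lsuc)
open import Algebra.Bundles using (CommutativeRing)
open import Data.Nat using (ℕ; zero; suc)
open import Data.Fin using (Fin; zero; suc)
open import Data.Product using (∃; _,_)
open import Relation.Binary.Core using (Rel)
open import Relation.Binary.Definitions using (Decidable)
open import Relation.Binary.PropositionalEquality using (_≡_)
open import Relation.Nullary using (¬_; yes; no)

-- Equality is assumed decidable (true for any finite field).
record FiniteField (c ℓ : Level) : Set (lsuc (c ⊔ ℓ)) where
  field
    commRing : CommutativeRing c ℓ
  open CommutativeRing commRing public
  field
    _≟_             : Decidable _≈_
    0≉1             : ¬ (0# ≈ 1#)
    inverse         : ∀ x → ¬ (x ≈ 0#) → ∃ λ y → x * y ≈ 1#
    order           : ℕ
    enum            : Fin order → Carrier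
    enum-injective  : ∀ i j → enum i ≈ enum j → i ≡ j
    enum-surjective : ∀ x → ∃ λ i → enum i ≈ x

module FF {c ℓ : Level} (F : FiniteField c ℓ) where
  open FiniteField F using (Carrier; _≈_; _+_; _*_; 0#; _≟_)

  -- The r-dimensional vector space F^r (coordinates w.r.t. a fixed basis).
  V : ℕ → Set c
  V r = Fin r → Carrier

  _≈ᵥ_ : ∀ {r} → Rel (V r) ℓ
  u ≈ᵥ v = ∀ k → u k ≈ v k

  0ᵥ : ∀ {r} → V r
  0ᵥ _ = 0#

  _+ᵥ_ : ∀ {r} → V r → V r → V r
  (u +ᵥ v) k = u k + v k

  _•_ : ∀ {r} → Carrier → V r → V r
  (λ' • v) k = λ' * v k

  sumᵥ : ∀ {r} n → (Fin n → V r) → V r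
  sumᵥ zero    f = 0ᵥ
  sumᵥ (suc n) f = f zero +ᵥ sumᵥ n (λ i → f (suc i))

  -- A finite subset A of V with |A| = n, given as an injective family.
  InjectiveFamily : ∀ {r n} → (Fin n → V r) → Set ℓ
  InjectiveFamily {n = n} a = ∀ (i j : Fin n) → a i ≈ᵥ a j → i ≡ j

  supportSize : ∀ n → (Fin n → Carrier) → ℕ
  supportSize zero    γ = zero
  supportSize (suc n) γ with γ zero ≟ 0#
  ... | yes _ = supportSize n (λ i → γ (suc i))
  ... | no  _ = suc (supportSize n (λ i → γ (suc i)))

  linComb : ∀ {r n} → (Fin n → V r) → (Fin n → Carrier) → V r
  linComb {n = n} a γ = sumᵥ n (λ i → γ i • a i)

  -- An h-linear combination of A (omitting permutations of the summands) is
  -- a coefficient function γ on A with exactly h nonzero entries.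
  -- A is S_h-linear if distinct h-linear combinations give distinct vectors,
  -- where combinations differing only at the coefficient of 0 are identified.
  IsShLinear : ∀ {r n} → (Fin n → V r) → ℕ → Set (c ⊔ ℓ)
  IsShLinear {n = n} a h =
    ∀ (γ δ : Fin n → Carrier) →
      supportSize n γ ≡ h → supportSize n δ ≡ h →
      linComb a γ ≈ᵥ linComb a δ →
      ∀ i → ¬ (a i ≈ᵥ 0ᵥ) → γ i ≈ δ i

-- Let b enumerate A ∪ {0}, with the zero vector at j₀.  Combinations putting no weight on b j₀ are
-- combinations of A, so the hypothesis applies to them.  If of two equal h-combinations only γ uses
-- the zero vector, some y lies outside the support of γ but inside that of δ; choosing c ≠ 0 with
-- c + δ y ≠ 0 (possible since q ≠ 2), move the weight of γ at j₀ to c at y and add c to the weight of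
-- δ at y: the two new zero-free h-combinations are equal but differ at y.  If both use the zero
-- vector, 2h < r ≤ |A| leaves a position x outside both supports, and moving both weights at j₀ to
-- weight 1 at x reduces to the zero-free case.

module Submission where

open import Defs
open import Level using (Level; _⊔_)
open import Algebra.Bundles using (CommutativeMonoid)
open import Data.Nat as ℕ using (ℕ; zero; suc)
import Data.Nat.Properties as ℕ
open import Data.Fin using (Fin; zero; suc; punchIn)
open import Data.Fin.Properties using (punchInᵢ≢i; injective⇒≤) renaming (_≟_ to _≟ᶠ_)
open import Data.Product as Σ using (∃; _,_; _×_; proj₁; proj₂)
open import Data.Sum as ⊎ using (_⊎_; inj₁; inj₂)
open import Data.Empty using (⊥; ⊥-elim)
open import Function using (_∘_; const; id)
open import Data.Vec.Functional using (updateAt)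
open import Data.Vec.Functional.Properties using (updateAt-updates; updateAt-minimal)
open import Function.Definitions using (Injective)
open import Relation.Nullary using (¬_; Dec; yes; no)
open import Relation.Binary.PropositionalEquality as ≡ using (_≡_; _≢_)

module MonoidSums {a ℓ : Level} (M : CommutativeMonoid a ℓ) where
  open CommutativeMonoid M renaming (_∙_ to _+_; ε to 0#)
  open import Algebra.Properties.CommutativeMonoid.Sum M public
  open import Relation.Binary.Reasoning.Setoid setoid

  sum-vanishing : ∀ {n} (f : Fin n → Carrier) → (∀ i → f i ≈ 0#) → sum f ≈ 0#
  sum-vanishing {n} f f≈0 = trans (sum-cong-≋ f≈0) (sum-replicate-zero n)

  sum-concentrated : ∀ {n} (f : Fin n → Carrier) (i : Fin n) →
                     (∀ j → j ≢ i → f j ≈ 0#) → sum f ≈ f i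
  sum-concentrated {suc n} f i f≈0 = begin
    sum f                          ≈⟨ sum-remove f ⟩
    f i + sum (f ∘ punchIn i)      ≈⟨ ∙-congˡ (sum-vanishing _ (λ j → f≈0 _ (punchInᵢ≢i i j))) ⟩
    f i + 0#                       ≈⟨ identityʳ _ ⟩
    f i                            ∎

  sum-exchange : ∀ {n} (f g : Fin n → Carrier) (i : Fin n) →
                 (∀ j → j ≢ i → f j ≈ g j) → sum f + g i ≈ sum g + f i
  sum-exchange {suc n} f g i f≈g = begin
    sum f + g i                          ≈⟨ ∙-congʳ (sum-remove f) ⟩
    (f i + sum (f ∘ punchIn i)) + g i    ≈⟨ ∙-congʳ (∙-congˡ (sum-cong-≋ (λ j → f≈g _ (punchInᵢ≢i i j)))) ⟩
    (f i + sum (g ∘ punchIn i)) + g i    ≈⟨ assoc _ _ _ ⟩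
    f i + (sum (g ∘ punchIn i) + g i)    ≈⟨ comm _ _ ⟩
    (sum (g ∘ punchIn i) + g i) + f i    ≈⟨ ∙-congʳ (comm _ _) ⟩
    (g i + sum (g ∘ punchIn i)) + f i    ≈⟨ ∙-congʳ (sym (sum-remove g)) ⟩
    sum g + f i                          ∎

  private
    select : ∀ {p} {P : Set p} → Dec P → Carrier → Carrier
    select (yes _) x = x
    select (no _)  _ = 0#

  -- Both sides equal the sum of the matrix whose row i carries f (σ i) in column σ i.
  sum-reindex : ∀ {m n} (σ : Fin n → Fin m) → Injective _≡_ _≡_ σ →
                (f : Fin m → Carrier) → (∀ j → f j ≈ 0# ⊎ ∃ λ i → σ i ≡ j) →
                sum (f ∘ σ) ≈ sum f
  sum-reindex {m} {n} σ σ-injective f f-supported = begin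
    sum (f ∘ σ)                  ≈⟨ sum-cong-≋ (λ i → sym (row i)) ⟩
    ∑[ i < n ] ∑[ j < m ] t i j  ≈⟨ ∑-comm t ⟩
    ∑[ j < m ] ∑[ i < n ] t i j  ≈⟨ sum-cong-≋ column ⟩
    sum f                        ∎
    where
    t : Fin n → Fin m → Carrier
    t i j = select (σ i ≟ᶠ j) (f j)

    t-diagonal : ∀ i → t i (σ i) ≈ f (σ i)
    t-diagonal i with σ i ≟ᶠ σ i
    ... | yes _  = refl
    ... | no σi≢σi = ⊥-elim (σi≢σi ≡.refl)

    t-off : ∀ i j → σ i ≢ j → t i j ≈ 0#
    t-off i j σi≢j with σ i ≟ᶠ j
    ... | yes σi≡j = ⊥-elim (σi≢j σi≡j)
    ... | no _     = refl

    row : ∀ i → sum (t i) ≈ f (σ i)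
    row i = trans (sum-concentrated (t i) (σ i) (λ j j≢σi → t-off i j (j≢σi ∘ ≡.sym))) (t-diagonal i)

    column : ∀ j → sum (λ i → t i j) ≈ f j
    column j with f-supported j
    ... | inj₁ fj≈0 = trans (sum-vanishing _ t≈0) (sym fj≈0)
      where
      t≈0 : ∀ i → t i j ≈ 0#
      t≈0 i with σ i ≟ᶠ j
      ... | yes _ = fj≈0
      ... | no _  = refl
    ... | inj₂ (i , ≡.refl) =
      trans (sum-concentrated _ i (λ i′ i′≢i → t-off i′ (σ i) (i′≢i ∘ σ-injective))) (t-diagonal i)

_[_]≔_ : ∀ {a} {A : Set a} {n} → (Fin n → A) → Fin n → A → Fin n → A
xs [ i ]≔ x = updateAt xs i (const x)

module ZeroAdjunction {c ℓ : Level} (F : FiniteField c ℓ) where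
  open FiniteField F hiding (zero)
  open FF F
  open import Algebra.Properties.Group +-group using (∙-cancelˡ; ∙-cancelʳ; inverseˡ-unique)
  module ℕ-Sum = MonoidSums ℕ.+-0-commutativeMonoid
  module F-Sum = MonoidSums +-commutativeMonoid

  private
    avoiding-two : ∀ u v x y z → x ≉ y → x ≉ z → y ≉ z → ∃ λ w → w ≉ u × w ≉ v
    avoiding-two u v x y z x≉y x≉z y≉z with x ≟ u | x ≟ v
    ... | no x≉u | no x≉v = x , x≉u , x≉v
    ... | yes x≈u | _ with y ≟ v
    ...   | no y≉v  = y , (λ y≈u → x≉y (trans x≈u (sym y≈u))) , y≉v
    ...   | yes y≈v = z , (λ z≈u → x≉z (trans x≈u (sym z≈u))) , (λ z≈v → y≉z (trans y≈v (sym z≈v)))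
    avoiding-two u v x y z x≉y x≉z y≉z | no _ | yes x≈v with y ≟ u
    ...   | no y≉u  = y , y≉u , (λ y≈v → x≉y (trans x≈v (sym y≈v)))
    ...   | yes y≈u = z , (λ z≈u → y≉z (trans y≈u (sym z≈u))) , (λ z≈v → x≉z (trans x≈v (sym z≈v)))

  ∃-avoiding-two : order ≢ 2 → ∀ u v → ∃ λ w → w ≉ u × w ≉ v
  ∃-avoiding-two = go order enum enum-injective enum-surjective
    where
    go : ∀ o (e : Fin o → Carrier) → (∀ i j → e i ≈ e j → i ≡ j) → (∀ x → ∃ λ i → e i ≈ x) →
         o ≢ 2 → ∀ u v → ∃ λ w → w ≉ u × w ≉ v
    go 0 _ _ onto _ _ _ with onto 0#
    ... | () , _
    go 1 e _ onto _ _ _ with onto 0# | onto 1#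
    ... | zero , e≈0 | zero , e≈1 = ⊥-elim (0≉1 (trans (sym e≈0) e≈1))
    go 2 _ _ _ o≢2 _ _ = ⊥-elim (o≢2 ≡.refl)
    go (suc (suc (suc _))) e injective _ _ u v =
      avoiding-two u v (e zero) (e (suc zero)) (e (suc (suc zero)))
        ((λ ()) ∘ injective _ _) ((λ ()) ∘ injective _ _) ((λ ()) ∘ injective _ _)

  ∃-nonzero-avoiding : order ≢ 2 → ∀ d → ∃ λ c → c ≉ 0# × c + d ≉ 0#
  ∃-nonzero-avoiding q≢2 d with ∃-avoiding-two q≢2 0# (- d)
  ... | c , c≉0 , c≉-d = c , c≉0 , c≉-d ∘ inverseˡ-unique c d

  indicator≉0 : Carrier → ℕ
  indicator≉0 x with x ≟ 0#
  ... | yes _ = 0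
  ... | no _  = 1

  indicator≉0-cong : ∀ {x y} → (x ≈ 0# → y ≈ 0#) → (y ≈ 0# → x ≈ 0#) → indicator≉0 x ≡ indicator≉0 y
  indicator≉0-cong {x} {y} x⇒y y⇒x with x ≟ 0# | y ≟ 0#
  ... | yes _   | yes _   = ≡.refl
  ... | yes x≈0 | no y≉0  = ⊥-elim (y≉0 (x⇒y x≈0))
  ... | no x≉0  | yes y≈0 = ⊥-elim (x≉0 (y⇒x y≈0))
  ... | no _    | no _    = ≡.refl

  supportSize≡sum : ∀ m (γ : Fin m → Carrier) → supportSize m γ ≡ ℕ-Sum.sum (indicator≉0 ∘ γ)
  supportSize≡sum zero    γ = ≡.refl
  supportSize≡sum (suc m) γ with γ zero ≟ 0#
  ... | yes _ = supportSize≡sum m (γ ∘ suc)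
  ... | no _  = ≡.cong suc (supportSize≡sum m (γ ∘ suc))

  ∃-common-zero : ∀ m (f g : Fin m → Carrier) → supportSize m f ℕ.+ supportSize m g ℕ.< m →
                  ∃ λ j → f j ≈ 0# × g j ≈ 0#
  ∃-common-zero (suc m) f g size< with f zero ≟ 0# | g zero ≟ 0#
  ... | yes f0≈0 | yes g0≈0 = zero , f0≈0 , g0≈0
  ... | yes _ | no _ = Σ.map suc id (∃-common-zero m (f ∘ suc) (g ∘ suc)
                         (ℕ.≤-pred (≡.subst (ℕ._< suc m) (ℕ.+-suc _ _) size<)))
  ... | no _  | yes _ = Σ.map suc id (∃-common-zero m (f ∘ suc) (g ∘ suc) (ℕ.≤-pred size<))
  ... | no _  | no _  = Σ.map suc id (∃-common-zero m (f ∘ suc) (g ∘ suc)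
                          (ℕ.<-trans (ℕ.+-monoʳ-< _ (ℕ.n<1+n _)) (ℕ.≤-pred size<)))

  ∃-zero-nonzero : ∀ m (f g : Fin m → Carrier) → supportSize m f ℕ.< supportSize m g →
                   ∃ λ j → f j ≈ 0# × g j ≉ 0#
  ∃-zero-nonzero (suc m) f g size< with f zero ≟ 0# | g zero ≟ 0#
  ... | yes f0≈0 | no g0≉0 = zero , f0≈0 , g0≉0
  ... | yes _ | yes _ = Σ.map suc id (∃-zero-nonzero m (f ∘ suc) (g ∘ suc) size<)
  ... | no _  | no _  = Σ.map suc id (∃-zero-nonzero m (f ∘ suc) (g ∘ suc) (ℕ.≤-pred size<))
  ... | no _  | yes _ = Σ.map suc id (∃-zero-nonzero m (f ∘ suc) (g ∘ suc) (ℕ.<-trans (ℕ.n<1+n _) size<))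

  indicator≉0-zero : ∀ {x} → x ≈ 0# → indicator≉0 x ≡ 0
  indicator≉0-zero {x} x≈0 with x ≟ 0#
  ... | yes _   = ≡.refl
  ... | no x≉0  = ⊥-elim (x≉0 x≈0)

  indicator≉0-nonzero : ∀ {x} → x ≉ 0# → indicator≉0 x ≡ 1
  indicator≉0-nonzero {x} x≉0 with x ≟ 0#
  ... | yes x≈0 = ⊥-elim (x≉0 x≈0)
  ... | no _    = ≡.refl

  supportSize-update : ∀ m (γ : Fin m → Carrier) x v →
    supportSize m (γ [ x ]≔ v) ℕ.+ indicator≉0 (γ x) ≡ supportSize m γ ℕ.+ indicator≉0 v
  supportSize-update m γ x v = begin
    supportSize m (γ [ x ]≔ v) ℕ.+ indicator≉0 (γ x)
      ≡⟨ ≡.cong (ℕ._+ _) (supportSize≡sum m _) ⟩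
    ℕ-Sum.sum (indicator≉0 ∘ (γ [ x ]≔ v)) ℕ.+ indicator≉0 (γ x)
      ≡⟨ ℕ-Sum.sum-exchange _ _ x (λ j j≢x → ≡.cong indicator≉0 (updateAt-minimal j x γ j≢x)) ⟩
    ℕ-Sum.sum (indicator≉0 ∘ γ) ℕ.+ indicator≉0 ((γ [ x ]≔ v) x)
      ≡⟨ ≡.cong₂ ℕ._+_ (≡.sym (supportSize≡sum m γ)) (≡.cong indicator≉0 (updateAt-updates x γ)) ⟩
    supportSize m γ ℕ.+ indicator≉0 v ∎
    where open ≡.≡-Reasoning

  supportSize-update-cong : ∀ m (γ : Fin m → Carrier) x v → (γ x ≈ 0# → v ≈ 0#) → (v ≈ 0# → γ x ≈ 0#) →
                            supportSize m (γ [ x ]≔ v) ≡ supportSize m γ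
  supportSize-update-cong m γ x v γx⇒v v⇒γx = ℕ.+-cancelʳ-≡ (indicator≉0 (γ x)) _ _
    (≡.trans (supportSize-update m γ x v) (≡.cong (supportSize m γ ℕ.+_) (indicator≉0-cong v⇒γx γx⇒v)))

  supportSize-clear : ∀ m (γ : Fin m → Carrier) x → γ x ≉ 0# → suc (supportSize m (γ [ x ]≔ 0#)) ≡ supportSize m γ
  supportSize-clear m γ x γx≉0 = ≡.trans (ℕ.+-comm 1 _) (≡.trans update (ℕ.+-identityʳ _))
    where
    update : supportSize m (γ [ x ]≔ 0#) ℕ.+ 1 ≡ supportSize m γ ℕ.+ 0
    update = ≡.subst₂ (λ i j → supportSize m (γ [ x ]≔ 0#) ℕ.+ i ≡ supportSize m γ ℕ.+ j)
               (indicator≉0-nonzero γx≉0) (indicator≉0-zero refl) (supportSize-update m γ x 0#)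

  supportSize-fill : ∀ m (γ : Fin m → Carrier) x v → γ x ≈ 0# → v ≉ 0# →
                     supportSize m (γ [ x ]≔ v) ≡ suc (supportSize m γ)
  supportSize-fill m γ x v γx≈0 v≉0 = ≡.trans (≡.sym (ℕ.+-identityʳ _)) (≡.trans update (ℕ.+-comm _ 1))
    where
    update : supportSize m (γ [ x ]≔ v) ℕ.+ 0 ≡ supportSize m γ ℕ.+ 1
    update = ≡.subst₂ (λ i j → supportSize m (γ [ x ]≔ v) ℕ.+ i ≡ supportSize m γ ℕ.+ j)
               (indicator≉0-zero γx≈0) (indicator≉0-nonzero v≉0) (supportSize-update m γ x v)

  linComb-coordinate : ∀ {r m} (b : Fin m → V r) γ k → linComb b γ k ≡ F-Sum.sum (λ j → γ j * b j k)
  linComb-coordinate {m = zero}  b γ k = ≡.refl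
  linComb-coordinate {m = suc m} b γ k = ≡.cong (γ zero * b zero k +_) (linComb-coordinate (b ∘ suc) (γ ∘ suc) k)

  linComb-update : ∀ {r m} (b : Fin m → V r) γ x v k →
                   linComb b (γ [ x ]≔ v) k + γ x * b x k ≈ linComb b γ k + v * b x k
  linComb-update b γ x v k = begin
    linComb b (γ [ x ]≔ v) k + γ x * b x k
      ≡⟨ ≡.cong (_+ _) (linComb-coordinate b _ k) ⟩
    F-Sum.sum (λ j → (γ [ x ]≔ v) j * b j k) + γ x * b x k
      ≈⟨ F-Sum.sum-exchange _ _ x (λ j j≢x → *-congʳ (reflexive (updateAt-minimal j x γ j≢x))) ⟩
    F-Sum.sum (λ j → γ j * b j k) + (γ [ x ]≔ v) x * b x k
      ≡⟨ ≡.cong₂ _+_ (≡.sym (linComb-coordinate b γ k)) (≡.cong (_* b x k) (updateAt-updates x γ)) ⟩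
    linComb b γ k + v * b x k ∎
    where open import Relation.Binary.Reasoning.Setoid setoid

  linComb-shift : ∀ {r m} (b : Fin m → V r) γ x {v} w → v ≈ w + γ x →
                  linComb b (γ [ x ]≔ v) ≈ᵥ (linComb b γ +ᵥ (w • b x))
  linComb-shift b γ x {v} w v≈w+γx k = ∙-cancelʳ (γ x * b x k) _ _ (begin
    linComb b (γ [ x ]≔ v) k + γ x * b x k     ≈⟨ linComb-update b γ x v k ⟩
    linComb b γ k + v * b x k                  ≈⟨ +-congˡ (trans (*-congʳ v≈w+γx) (distribʳ _ _ _)) ⟩
    linComb b γ k + (w * b x k + γ x * b x k)  ≈⟨ +-assoc _ _ _ ⟨
    (linComb b γ k + w * b x k) + γ x * b x k  ∎)
    where open import Relation.Binary.Reasoning.Setoid setoid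

  linComb-clear : ∀ {r m} (b : Fin m → V r) γ x v → b x ≈ᵥ 0ᵥ → linComb b (γ [ x ]≔ v) ≈ᵥ linComb b γ
  linComb-clear b γ x v bx≈0 k = begin
    linComb b (γ [ x ]≔ v) k                   ≈⟨ +-identityʳ _ ⟨
    linComb b (γ [ x ]≔ v) k + 0#              ≈⟨ +-congˡ (vanishes (γ x)) ⟨
    linComb b (γ [ x ]≔ v) k + γ x * b x k     ≈⟨ linComb-update b γ x v k ⟩
    linComb b γ k + v * b x k                  ≈⟨ +-congˡ (vanishes v) ⟩
    linComb b γ k + 0#                         ≈⟨ +-identityʳ _ ⟩
    linComb b γ k                              ∎
    where
    open import Relation.Binary.Reasoning.Setoid setoid
    vanishes : ∀ u → u * b x k ≈ 0#
    vanishes u = trans (*-congˡ (bx≈0 k)) (zeroʳ u)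

  VanishesOnZeros : ∀ {r m} → (Fin m → V r) → (Fin m → Carrier) → Set ℓ
  VanishesOnZeros b γ = ∀ j → b j ≈ᵥ 0ᵥ → γ j ≈ 0#

  IsShLinearAwayFromZero : ∀ {r m} → (Fin m → V r) → ℕ → Set (c ⊔ ℓ)
  IsShLinearAwayFromZero {m = m} b h =
    ∀ γ δ → VanishesOnZeros b γ → VanishesOnZeros b δ →
      supportSize m γ ≡ h → supportSize m δ ≡ h →
      linComb b γ ≈ᵥ linComb b δ →
      ∀ j → ¬ (b j ≈ᵥ 0ᵥ) → γ j ≈ δ j

  module Embedding {r n m} {a : Fin n → V r} {b : Fin m → V r}
                   (a-injective : InjectiveFamily a) (b-injective : InjectiveFamily b)
                   (a⊆b : ∀ i → ∃ λ j → b j ≈ᵥ a i) (b⊆a∪0 : ∀ j → (b j ≈ᵥ 0ᵥ) ⊎ ∃ λ i → b j ≈ᵥ a i) where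

    σ : Fin n → Fin m
    σ = proj₁ ∘ a⊆b

    b∘σ≈a : ∀ i → b (σ i) ≈ᵥ a i
    b∘σ≈a = proj₂ ∘ a⊆b

    σ-injective : Injective _≡_ _≡_ σ
    σ-injective {i} {i′} σi≡σi′ = a-injective i i′ λ k →
      trans (sym (b∘σ≈a i k)) (trans (reflexive (≡.cong (λ j → b j k) σi≡σi′)) (b∘σ≈a i′ k))

    σ-covers : ∀ j → (b j ≈ᵥ 0ᵥ) ⊎ ∃ λ i → σ i ≡ j
    σ-covers j with b⊆a∪0 j
    ... | inj₁ bj≈0        = inj₁ bj≈0
    ... | inj₂ (i , bj≈ai) = inj₂ (i , ≡.sym (b-injective j (σ i) λ k → trans (bj≈ai k) (sym (b∘σ≈a i k))))

    n≤m : n ℕ.≤ m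
    n≤m = injective⇒≤ σ-injective

    linComb-reindex : ∀ γ → linComb a (γ ∘ σ) ≈ᵥ linComb b γ
    linComb-reindex γ k = begin
      linComb a (γ ∘ σ) k                     ≡⟨ linComb-coordinate a (γ ∘ σ) k ⟩
      F-Sum.sum (λ i → γ (σ i) * a i k)       ≈⟨ F-Sum.sum-cong-≋ (λ i → *-congˡ (sym (b∘σ≈a i k))) ⟩
      F-Sum.sum (λ i → γ (σ i) * b (σ i) k)   ≈⟨ F-Sum.sum-reindex σ σ-injective _ terms-covered ⟩
      F-Sum.sum (λ j → γ j * b j k)           ≡⟨ linComb-coordinate b γ k ⟨
      linComb b γ k                           ∎
      where
      open import Relation.Binary.Reasoning.Setoid setoid
      terms-covered : ∀ j → (γ j * b j k ≈ 0#) ⊎ ∃ λ i → σ i ≡ j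
      terms-covered j = ⊎.map₁ (λ bj≈0 → trans (*-congˡ (bj≈0 k)) (zeroʳ _)) (σ-covers j)

    supportSize-reindex : ∀ γ → VanishesOnZeros b γ → supportSize n (γ ∘ σ) ≡ supportSize m γ
    supportSize-reindex γ γ-vanishes = begin
      supportSize n (γ ∘ σ)               ≡⟨ supportSize≡sum n (γ ∘ σ) ⟩
      ℕ-Sum.sum (indicator≉0 ∘ γ ∘ σ)     ≡⟨ ℕ-Sum.sum-reindex σ σ-injective _ terms-covered ⟩
      ℕ-Sum.sum (indicator≉0 ∘ γ)         ≡⟨ supportSize≡sum m γ ⟨
      supportSize m γ                     ∎
      where
      open ≡.≡-Reasoning
      terms-covered : ∀ j → (indicator≉0 (γ j) ≡ 0) ⊎ ∃ λ i → σ i ≡ j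
      terms-covered j = ⊎.map₁ (indicator≉0-zero ∘ γ-vanishes j) (σ-covers j)

    isShLinear⇒awayFromZero : ∀ {h} → IsShLinear a h → IsShLinearAwayFromZero b h
    isShLinear⇒awayFromZero a-Sh γ δ γ-vanishes δ-vanishes |γ| |δ| γ~δ j bj≉0 with σ-covers j
    ... | inj₁ bj≈0         = ⊥-elim (bj≉0 bj≈0)
    ... | inj₂ (i , ≡.refl) =
      a-Sh (γ ∘ σ) (δ ∘ σ)
        (≡.trans (supportSize-reindex γ γ-vanishes) |γ|) (≡.trans (supportSize-reindex δ δ-vanishes) |δ|)
        (λ k → trans (linComb-reindex γ k) (trans (γ~δ k) (sym (linComb-reindex δ k))))
        i (λ ai≈0 → bj≉0 λ k → trans (b∘σ≈a i k) (ai≈0 k))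

  module AdjoinZero (q≢2 : order ≢ 2) {r m h} {b : Fin m → V r} {j₀ : Fin m}
                    (b-injective : InjectiveFamily b) (b-j₀ : b j₀ ≈ᵥ 0ᵥ)
                    (h+h<m : h ℕ.+ h ℕ.< m) (b-Sh : IsShLinearAwayFromZero b h) where

    zero-unique : ∀ j → b j ≈ᵥ 0ᵥ → j ≡ j₀
    zero-unique j bj≈0 = b-injective j j₀ λ k → trans (bj≈0 k) (sym (b-j₀ k))

    vanishesOnZeros : ∀ γ → γ j₀ ≈ 0# → VanishesOnZeros b γ
    vanishesOnZeros γ γj₀≈0 j bj≈0 rewrite zero-unique j bj≈0 = γj₀≈0

    b-nonzero : ∀ {j} → j ≢ j₀ → ¬ (b j ≈ᵥ 0ᵥ)
    b-nonzero j≢j₀ = j≢j₀ ∘ zero-unique _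

    relocate : (Fin m → Carrier) → Fin m → Carrier → Fin m → Carrier
    relocate γ x v = (γ [ j₀ ]≔ 0#) [ x ]≔ v

    module _ (γ : Fin m → Carrier) {x} (x≢j₀ : x ≢ j₀) (v : Carrier) where

      private
        cleared-x : (γ [ j₀ ]≔ 0#) x ≡ γ x
        cleared-x = updateAt-minimal x j₀ γ x≢j₀

      relocate-j₀ : relocate γ x v j₀ ≈ 0#
      relocate-j₀ = reflexive (≡.trans (updateAt-minimal j₀ x _ (x≢j₀ ∘ ≡.sym)) (updateAt-updates j₀ γ))

      relocate-at : relocate γ x v x ≡ v
      relocate-at = updateAt-updates x _

      relocate-elsewhere : ∀ {j} → j ≢ x → j ≢ j₀ → relocate γ x v j ≡ γ j
      relocate-elsewhere j≢x j≢j₀ = ≡.trans (updateAt-minimal _ x _ j≢x) (updateAt-minimal _ j₀ γ j≢j₀)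

      supportSize-relocate : γ j₀ ≉ 0# → γ x ≈ 0# → v ≉ 0# → supportSize m (relocate γ x v) ≡ supportSize m γ
      supportSize-relocate γj₀≉0 γx≈0 v≉0 = ≡.trans
        (supportSize-fill m _ x v (trans (reflexive cleared-x) γx≈0) v≉0)
        (supportSize-clear m γ j₀ γj₀≉0)

      linComb-relocate : γ x ≈ 0# → linComb b (relocate γ x v) ≈ᵥ (linComb b γ +ᵥ (v • b x))
      linComb-relocate γx≈0 k = trans
        (linComb-shift b _ x v (sym (trans (+-congˡ (trans (reflexive cleared-x) γx≈0)) (+-identityʳ v))) k)
        (+-congʳ (linComb-clear b γ j₀ 0# b-j₀ k))

    one-sided-zero-impossible : ∀ γ δ → supportSize m γ ≡ h → supportSize m δ ≡ h → linComb b γ ≈ᵥ linComb b δ →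
                    γ j₀ ≉ 0# → δ j₀ ≈ 0# → ⊥
    one-sided-zero-impossible γ δ |γ| |δ| γ~δ γj₀≉0 δj₀≈0
      with ∃-zero-nonzero m (γ [ j₀ ]≔ 0#) δ
             (≡.subst (ℕ._≤ supportSize m δ) (≡.sym (supportSize-clear m γ j₀ γj₀≉0))
                      (ℕ.≤-reflexive (≡.trans |γ| (≡.sym |δ|))))
    ... | y , γ°y≈0 , δy≉0 with ∃-nonzero-avoiding q≢2 (δ y)
    ... | c , c≉0 , c+δy≉0 = δy≉0 (sym (∙-cancelˡ c 0# (δ y) (trans (+-identityʳ c) c≈c+δy)))
      where
      y≢j₀ : y ≢ j₀
      y≢j₀ ≡.refl = δy≉0 δj₀≈0
      γy≈0 : γ y ≈ 0#
      γy≈0 = trans (reflexive (≡.sym (updateAt-minimal y j₀ γ y≢j₀))) γ°y≈0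
      δ′ : Fin m → Carrier
      δ′ = δ [ y ]≔ (c + δ y)
      δ′-vanishes : VanishesOnZeros b δ′
      δ′-vanishes = vanishesOnZeros δ′ (trans (reflexive (updateAt-minimal j₀ y δ (y≢j₀ ∘ ≡.sym))) δj₀≈0)
      |δ′| : supportSize m δ′ ≡ h
      |δ′| = ≡.trans (supportSize-update-cong m δ y _ (⊥-elim ∘ δy≉0) (⊥-elim ∘ c+δy≉0)) |δ|
      γ′~δ′ : linComb b (relocate γ y c) ≈ᵥ linComb b δ′
      γ′~δ′ k = trans (linComb-relocate γ y≢j₀ c γy≈0 k)
                  (trans (+-congʳ (γ~δ k)) (sym (linComb-shift b δ y c refl k)))
      c≈c+δy : c ≈ c + δ y
      c≈c+δy = trans (reflexive (≡.sym (relocate-at γ y≢j₀ c)))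
        (trans (b-Sh _ δ′ (vanishesOnZeros _ (relocate-j₀ γ y≢j₀ c)) δ′-vanishes
                  (≡.trans (supportSize-relocate γ y≢j₀ c γj₀≉0 γy≈0 c≉0) |γ|) |δ′| γ′~δ′ y (b-nonzero y≢j₀))
          (reflexive (updateAt-updates y δ)))

    two-sided-zero-agree : ∀ γ δ → supportSize m γ ≡ h → supportSize m δ ≡ h → linComb b γ ≈ᵥ linComb b δ →
                      γ j₀ ≉ 0# → δ j₀ ≉ 0# → ∀ j → ¬ (b j ≈ᵥ 0ᵥ) → γ j ≈ δ j
    two-sided-zero-agree γ δ |γ| |δ| γ~δ γj₀≉0 δj₀≉0 j bj≉0
      with ∃-common-zero m γ δ (≡.subst₂ (λ s t → s ℕ.+ t ℕ.< m) (≡.sym |γ|) (≡.sym |δ|) h+h<m)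
    ... | x , γx≈0 , δx≈0 with j ≟ᶠ x
    ... | yes ≡.refl = trans γx≈0 (sym δx≈0)
    ... | no j≢x = trans (reflexive (≡.sym (relocate-elsewhere γ x≢j₀ 1# j≢x j≢j₀)))
                     (trans γ′j≈δ′j (reflexive (relocate-elsewhere δ x≢j₀ 1# j≢x j≢j₀)))
      where
      x≢j₀ : x ≢ j₀
      x≢j₀ ≡.refl = γj₀≉0 γx≈0
      j≢j₀ : j ≢ j₀
      j≢j₀ ≡.refl = bj≉0 b-j₀
      1≉0 : 1# ≉ 0#
      1≉0 = 0≉1 ∘ sym
      γ′~δ′ : linComb b (relocate γ x 1#) ≈ᵥ linComb b (relocate δ x 1#)
      γ′~δ′ k = trans (linComb-relocate γ x≢j₀ 1# γx≈0 k)
                  (trans (+-congʳ (γ~δ k)) (sym (linComb-relocate δ x≢j₀ 1# δx≈0 k)))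
      γ′j≈δ′j : relocate γ x 1# j ≈ relocate δ x 1# j
      γ′j≈δ′j = b-Sh _ _ (vanishesOnZeros _ (relocate-j₀ γ x≢j₀ 1#)) (vanishesOnZeros _ (relocate-j₀ δ x≢j₀ 1#))
        (≡.trans (supportSize-relocate γ x≢j₀ 1# γj₀≉0 γx≈0 1≉0) |γ|)
        (≡.trans (supportSize-relocate δ x≢j₀ 1# δj₀≉0 δx≈0 1≉0) |δ|)
        γ′~δ′ j bj≉0

    awayFromZero⇒isShLinear : IsShLinear b h
    awayFromZero⇒isShLinear γ δ |γ| |δ| γ~δ j bj≉0 with γ j₀ ≟ 0# | δ j₀ ≟ 0#
    ... | yes γj₀≈0 | yes δj₀≈0 = b-Sh γ δ (vanishesOnZeros γ γj₀≈0) (vanishesOnZeros δ δj₀≈0) |γ| |δ| γ~δ j bj≉0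
    ... | no γj₀≉0  | yes δj₀≈0 = ⊥-elim (one-sided-zero-impossible γ δ |γ| |δ| γ~δ γj₀≉0 δj₀≈0)
    ... | yes γj₀≈0 | no δj₀≉0  = ⊥-elim (one-sided-zero-impossible δ γ |δ| |γ| (sym ∘ γ~δ) δj₀≉0 γj₀≈0)
    ... | no γj₀≉0  | no δj₀≉0  = two-sided-zero-agree γ δ |γ| |δ| γ~δ γj₀≉0 δj₀≉0 j bj≉0

open import Data.Nat using (ℕ; _≤_; _<_; _*_)
open import Relation.Binary.PropositionalEquality using (_≢_)

lemma3p10 : ∀ {c ℓ : Level} (F : FiniteField c ℓ) → FiniteField.order F ≢ 2 →
    let open FF F in
    (r n h : ℕ) (a : Fin n → V r) →
    InjectiveFamily a → 0 < n → 1 ≤ h → h ≤ n →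
    IsShLinear a h → 2 * h < r → r ≤ n →
    (m : ℕ) (b : Fin m → V r) → InjectiveFamily b →
    (∀ j → (b j ≈ᵥ 0ᵥ) ⊎ (∃ λ i → b j ≈ᵥ a i)) →
    (∃ λ j → b j ≈ᵥ 0ᵥ) →
    (∀ i → ∃ λ j → b j ≈ᵥ a i) →
    IsShLinear b h
lemma3p10 F q≢2 r n h a a-injective _ _ _ a-Sh 2h<r r≤n m b b-injective b⊆a∪0 (j₀ , b-j₀) a⊆b =
  awayFromZero⇒isShLinear
  where
  open ZeroAdjunction F
  open Embedding a-injective b-injective a⊆b b⊆a∪0
  h+h<m : h ℕ.+ h < m
  h+h<m = ℕ.<-≤-trans (≡.subst (_< r) (≡.cong (h ℕ.+_) (ℕ.+-identityʳ h)) 2h<r) (ℕ.≤-trans r≤n n≤m)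
  open AdjoinZero q≢2 b-injective b-j₀ h+h<m (isShLinear⇒awayFromZero a-Sh)
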